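{- Let $*$ be the rock-paper-scissors operation on $\{\text{rock},\text{paper},\text{scissors}\}$, defined by $x*y=y*x=x$ whenever $x$ beats $y$ or $x=y$, where rock beats scissors, scissors beat paper, and paper beats rock. Then $s^{\mathrm{ac}}_n(*)=D_{n-1}$ and $s_n(*)=C_{n-1}$ for all $n\ge1$.
   Context: For $X_n=\{x_1,\dots,x_n\}$, groupoid terms over $X_n$ are built recursively from variables by $(s,t)\mapsto (st)$. A full linear term over $X_n$ is a term in which each of $x_1,\dots,x_n$ occurs exactly once; a bracketing is a full linear term whose variables appear in order $x_1,\dots,x_n$ from left to right. Each term induces an $n$-ary term operation by interpreting juxtaposition as $*$. $s^{\mathrm{ac}}_n(*)$ (resp. $s_n(*)$) is the number of distinct term operations induced by full linear terms (resp. bracketings) over $X_n$. $C_m=\frac{1}{m+1}\binom{2m}{m}$ and $D_m=(2m)!/(2^m m!)$. -}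

module Defs where

open import Data.Nat using (ℕ; zero; suc; _+_; _*_; _^_)
open import Data.Nat.Properties using (_!≢0; m^n≢0; m*n≢0)
open import Data.Nat.DivMod using (_/_)
open import Data.Nat.Combinatorics using (_C_)
open import Data.Nat.Base using (_!)
open import Data.Fin using (Fin)
open import Data.List using (List; []; _∷_; _++_; length)
open import Data.List.Base using (allFin)
open import Data.List.Relation.Unary.All using (All)
open import Data.List.Relation.Unary.Any using (Any)
open import Data.List.Relation.Unary.AllPairs using (AllPairs)
open import Data.List.Relation.Binary.Permutation.Propositional using (_↭_)
open import Data.Product using (Σ; _×_; ∃)
open import Relation.Binary.PropositionalEquality using (_≡_; _≗_)
open import Relation.Nullary using (¬_)

data RPS : Set where
  rock paper scissors : RPS

_*ʳ_ : RPS → RPS → RPS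
rock     *ʳ rock     = rock
rock     *ʳ paper    = paper
rock     *ʳ scissors = rock
paper    *ʳ rock     = paper
paper    *ʳ paper    = paper
paper    *ʳ scissors = scissors
scissors *ʳ rock     = rock
scissors *ʳ paper    = scissors
scissors *ʳ scissors = scissors

data Term (n : ℕ) : Set where
  var : Fin n → Term n
  _·_ : Term n → Term n → Term n

leaves : ∀ {n} → Term n → List (Fin n)
leaves (var i) = i ∷ []
leaves (s · t) = leaves s ++ leaves t

FullLinear : ∀ {n} → Term n → Set
FullLinear {n} t = leaves t ↭ allFin n

Bracketing : ∀ {n} → Term n → Set
Bracketing {n} t = leaves t ≡ allFin n

Op : Set → ℕ → Set
Op A n = (Fin n → A) → A

⟦_⟧ : ∀ {A : Set} {n} → Term n → (A → A → A) → Op A n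
⟦ var i ⟧ _∙_ ρ = ρ i
⟦ s · t ⟧ _∙_ ρ = _∙_ (⟦ s ⟧ _∙_ ρ) (⟦ t ⟧ _∙_ ρ)

NumDistinctOps : ∀ {A : Set} → (A → A → A) → (n : ℕ) → (Term n → Set) → ℕ → Set
NumDistinctOps {A} _∙_ n P k =
  Σ (List (Op A n)) λ L →
    length L ≡ k
    × AllPairs (λ f g → ¬ (f ≗ g)) L
    × All (λ f → ∃ λ (t : Term n) → P t × (f ≗ ⟦ t ⟧ _∙_)) L
    × ((t : Term n) → P t → Any (λ f → f ≗ ⟦ t ⟧ _∙_) L)

s-ac : ∀ {A : Set} → (A → A → A) → ℕ → ℕ → Set
s-ac _∙_ n k = NumDistinctOps _∙_ n FullLinear k

s-br : ∀ {A : Set} → (A → A → A) → ℕ → ℕ → Set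
s-br _∙_ n k = NumDistinctOps _∙_ n Bracketing k

Catalan : ℕ → ℕ
Catalan m = ((2 * m) C m) / suc m

DoubleFact : ℕ → ℕ
DoubleFact m = ((2 * m) !) / (2 ^ m * m !)
  where instance
    _ = m^n≢0 2 m
    _ = m !≢0
    _ = m*n≢0 (2 ^ m) (m !)

-- The operation * is commutative and idempotent, so every term operation is induced by a canonical term,
-- one in which at every node the left factor contains the smaller least variable. Two canonical linear
-- terms inducing the same operation are equal: sending x_j to paper, the variables of a set S to scissors
-- and the others to rock, a product u₁ · u₂ with x_j in u₁ evaluates to scissors exactly when the variables
-- of u₂ lie in S, which recovers the top-level split, and freezing one factor at rock and at paper recovers
-- the operation of the other. So s^ac_{m+1} counts canonical full linear terms over x₀ … x_m, which arise by
-- attaching each new variable beside one of the 2k − 1 subterms (k = 1, …, m): D_m = 1 · 3 ⋯ (2m − 1) of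
-- them. Bracketings are canonical, so s_{m+1} counts binary trees with m + 1 leaves; enumerating them with
-- a shift-reduce parser gives ballot numbers, hence C_m.

module Submission where

open import Defs

open import Algebra.Definitions using (Commutative; Idempotent)
open import Data.Empty using (⊥-elim)
open import Data.Fin using (Fin; zero; suc; toℕ; fromℕ; inject₁; lower₁)
open import Data.Fin.Properties
  using (toℕ-injective; toℕ-inject₁; toℕ-fromℕ; inject₁-lower₁; inject₁-injective; fromℕ≢inject₁; ≤fromℕ)
  renaming (_≟_ to _≟ᶠ_)
open import Data.List using (List; []; _∷_; _++_; length; map; concatMap; allFin; take; drop)
open import Data.List.Membership.Propositional using (_∈_; _∉_; find)
open import Data.List.Membership.Propositional.Properties
  using (∈-++⁺ˡ; ∈-++⁺ʳ; ∈-++⁻; ∈-allFin; ∈-map⁺; ∈-map⁻; ∈-concatMap⁺; ∈-concatMap⁻)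
open import Data.List.Membership.Propositional.Properties.WithK using (unique∧set⇒bag)
open import Data.List.Properties
  using (∷-injectiveʳ; ++-assoc; map-++; length-map; length-++; length-tabulate; length-take; length-drop; take++drop≡id)
open import Data.List.Relation.Binary.BagAndSetEquality using (∼bag⇒↭)
open import Data.List.Relation.Binary.Disjoint.Propositional using (Disjoint)
import Data.List.Relation.Binary.Disjoint.Propositional.Properties as Disjoint
open import Data.List.Relation.Binary.Permutation.Propositional
  using (_↭_; ↭-refl; ↭-reflexive; ↭-sym; ↭-trans; ↭⇒↭ₛ; module PermutationReasoning)
open import Data.List.Relation.Binary.Permutation.Propositional.Properties
  using (∈-resp-↭; ↭-length; ++-comm; ++⁺; ++⁺ˡ; ++⁺ʳ; shift)
import Data.List.Relation.Binary.Permutation.Setoid.Properties as ↭ₛ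
open import Data.List.Relation.Binary.Subset.Propositional using (_⊆_)
open import Data.List.Relation.Unary.All as All using (All; []; _∷_)
open import Data.List.Relation.Unary.All.Properties using (++⁻ˡ; ++⁻ʳ; ¬Any⇒All¬)
import Data.List.Relation.Unary.All.Properties as All
open import Data.List.Relation.Unary.AllPairs as AllPairs using (AllPairs; []; _∷_)
import Data.List.Relation.Unary.AllPairs.Properties as AllPairs
open import Data.List.Relation.Unary.Any as Any using (Any; here; there; any?)
import Data.List.Relation.Unary.Any.Properties as Any
open import Data.List.Relation.Unary.Unique.Propositional using (Unique)
open import Data.List.Relation.Unary.Unique.Propositional.Properties using (allFin⁺)
import Data.List.Relation.Unary.Unique.Propositional.Properties as UniqueP
open import Data.Maybe using (Maybe; just; nothing)
open import Data.Maybe.Properties using (just-injective)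
open import Data.Nat
  using (ℕ; NonZero; zero; suc; _+_; _*_; _∸_; _^_; _!; z≤n; s≤s; s≤s⁻¹; _≤_; _<_; _≤?_; _<?_; _⊓_)
open import Data.Nat.Combinatorics using (_C_; nCk+nC[k+1]≡[n+1]C[k+1]; nC1≡n; nCk≡nC[n∸k])
open import Data.Nat.DivMod using (_/_; m*n/n≡m)
open import Data.Nat.ListAction using (sum)
open import Data.Nat.Properties
  using ( +-comm; +-assoc; +-suc; +-identityʳ; +-cancelʳ-≡; +-commutativeSemigroup; *-identityʳ; *-zeroʳ
        ; suc-injective; ≤-reflexive; ≤-trans; ≤-antisym; <⇒≤; <⇒≱; <-asym; ≮⇒≥; ≤∧≢⇒<; 1+n≰n; n≤1+n; n<1+n
        ; m<n⇒m<1+n; m≤n⇒m<n∨m≡n; m≤m+n; m≤n+m; +-mono-≤; m+n∸m≡n; m+n∸n≡m; ⊓-sel; ⊓-comm; m≤n⇒m⊓n≡m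
        ; m*n≢0; m^n≢0; _!≢0; module ≤-Reasoning)
open import Algebra.Properties.CommutativeSemigroup +-commutativeSemigroup using () renaming (interchange to +-interchange)
open import Data.Nat.Solver using (module +-*-Solver)
open import Data.Product using (_×_; _,_; ∃; proj₁; proj₂)
open import Data.Sum using (_⊎_; inj₁; inj₂)
open import Function using (_∘_; id)
open import Function.Bundles using (mk⇔)
open import Relation.Binary.PropositionalEquality
  using (_≡_; _≢_; _≗_; refl; sym; trans; cong; cong₂; subst; subst₂; setoid; module ≡-Reasoning)
open import Relation.Nullary using (¬_; Dec; yes; no)

*ʳ-comm : Commutative _≡_ _*ʳ_
*ʳ-comm rock     rock     = refl
*ʳ-comm rock     paper    = refl
*ʳ-comm rock     scissors = refl
*ʳ-comm paper    rock     = refl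
*ʳ-comm paper    paper    = refl
*ʳ-comm paper    scissors = refl
*ʳ-comm scissors rock     = refl
*ʳ-comm scissors paper    = refl
*ʳ-comm scissors scissors = refl

*ʳ-idem : Idempotent _≡_ _*ʳ_
*ʳ-idem rock     = refl
*ʳ-idem paper    = refl
*ʳ-idem scissors = refl

*ʳ-cancelʳ-rock-paper : ∀ x y → x *ʳ rock ≡ y *ʳ rock → x *ʳ paper ≡ y *ʳ paper → x ≡ y
*ʳ-cancelʳ-rock-paper rock     rock     _  _  = refl
*ʳ-cancelʳ-rock-paper paper    paper    _  _  = refl
*ʳ-cancelʳ-rock-paper scissors scissors _  _  = refl
*ʳ-cancelʳ-rock-paper rock     paper    () _
*ʳ-cancelʳ-rock-paper rock     scissors _  ()
*ʳ-cancelʳ-rock-paper paper    rock     () _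
*ʳ-cancelʳ-rock-paper paper    scissors () _
*ʳ-cancelʳ-rock-paper scissors rock     _  ()
*ʳ-cancelʳ-rock-paper scissors paper    () _

x*ʳrock≢scissors : ∀ x → x *ʳ rock ≢ scissors
x*ʳrock≢scissors rock     ()
x*ʳrock≢scissors paper    ()
x*ʳrock≢scissors scissors ()

Unique-resp-↭ : ∀ {A : Set} {xs ys : List A} → xs ↭ ys → Unique xs → Unique ys
Unique-resp-↭ {A} p = ↭ₛ.Unique-resp-↭ (setoid A) (↭⇒↭ₛ p)

Unique-++⁻ : ∀ {A : Set} (xs : List A) {ys} → Unique (xs ++ ys) → Unique xs × Unique ys × Disjoint xs ys
Unique-++⁻ []       u          = [] , u , λ { (() , _) }
Unique-++⁻ (x ∷ xs) (x∉ ∷ u) with Unique-++⁻ xs u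
... | uxs , uys , xs#ys = ++⁻ˡ xs x∉ ∷ uxs , uys , x∷xs#ys
  where
  x∷xs#ys : Disjoint (x ∷ xs) _
  x∷xs#ys (here refl , v∈ys) = All.lookup (++⁻ʳ xs x∉) v∈ys refl
  x∷xs#ys (there v∈xs , v∈ys) = xs#ys (v∈xs , v∈ys)

∉-++⁺ : ∀ {A : Set} {x : A} {xs ys} → x ∉ xs → x ∉ ys → x ∉ xs ++ ys
∉-++⁺ {xs = xs} x∉xs x∉ys x∈ with ∈-++⁻ xs x∈
... | inj₁ x∈xs = x∉xs x∈xs
... | inj₂ x∈ys = x∉ys x∈ys

Unique⇒AllPairs-¬ : ∀ {A : Set} {Q : A → Set} {R : A → A → Set} →
                    (∀ {x y} → Q x → Q y → R x y → x ≡ y) →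
                    ∀ {xs} → All Q xs → Unique xs → AllPairs (λ x y → ¬ R x y) xs
Unique⇒AllPairs-¬ R⇒≡ []        []         = []
Unique⇒AllPairs-¬ R⇒≡ (qx ∷ qs) (x∉ ∷ u) =
  All.zipWith (λ (x≢y , qy) → x≢y ∘ R⇒≡ qx qy) (x∉ , qs) ∷ Unique⇒AllPairs-¬ R⇒≡ qs u

AllPairs-++⁻ : ∀ {A : Set} {R : A → A → Set} xs {ys} → AllPairs R (xs ++ ys) →
               AllPairs R xs × AllPairs R ys × All (λ x → All (R x) ys) xs
AllPairs-++⁻ []       rs        = [] , rs , []
AllPairs-++⁻ (x ∷ xs) (rx ∷ rs) with AllPairs-++⁻ xs rs
... | rxs , rys , cross = ++⁻ˡ xs rx ∷ rxs , rys , ++⁻ʳ xs rx ∷ cross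

length-concatMap-const : ∀ {A B : Set} (f : A → List B) {k} xs →
                         (∀ {x} → x ∈ xs → length (f x) ≡ k) → length (concatMap f xs) ≡ length xs * k
length-concatMap-const f []       _ = refl
length-concatMap-const f (x ∷ xs) h =
  trans (length-++ (f x)) (cong₂ _+_ (h (here refl)) (length-concatMap-const f xs (h ∘ there)))

take-length-++ : ∀ {A : Set} (xs ys : List A) → take (length xs) (xs ++ ys) ≡ xs
take-length-++ []       ys = refl
take-length-++ (x ∷ xs) ys = cong (x ∷_) (take-length-++ xs ys)

drop-length-++ : ∀ {A : Set} (xs ys : List A) → drop (length xs) (xs ++ ys) ≡ ys
drop-length-++ []       ys = refl
drop-length-++ (x ∷ xs) ys = drop-length-++ xs ys

-- Terms and their term operations

var-injective : ∀ {n} {i j : Fin n} → var i ≡ var j → i ≡ j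
var-injective refl = refl

·-injectiveˡ : ∀ {n} {a b c d : Term n} → a · b ≡ c · d → a ≡ c
·-injectiveˡ refl = refl

·-injectiveʳ : ∀ {n} {a b c d : Term n} → a · b ≡ c · d → b ≡ d
·-injectiveʳ refl = refl

leaf-∃ : ∀ {n} (t : Term n) → ∃ λ i → i ∈ leaves t
leaf-∃ (var i) = i , here refl
leaf-∃ (s · t) with leaf-∃ s
... | i , i∈s = i , ∈-++⁺ˡ i∈s

module _ {A : Set} (_∙_ : A → A → A) where

  ⟦⟧-cong-leaves : ∀ {n} (t : Term n) {ρ σ : Fin n → A} →
                   (∀ {i} → i ∈ leaves t → ρ i ≡ σ i) → ⟦ t ⟧ _∙_ ρ ≡ ⟦ t ⟧ _∙_ σ
  ⟦⟧-cong-leaves (var i) h = h (here refl)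
  ⟦⟧-cong-leaves (s · t) h =
    cong₂ _∙_ (⟦⟧-cong-leaves s (h ∘ ∈-++⁺ˡ)) (⟦⟧-cong-leaves t (h ∘ ∈-++⁺ʳ (leaves s)))

  ⟦⟧-comm : Commutative _≡_ _∙_ → ∀ {n} (s t : Term n) → ⟦ s · t ⟧ _∙_ ≗ ⟦ t · s ⟧ _∙_
  ⟦⟧-comm comm s t ρ = comm (⟦ s ⟧ _∙_ ρ) (⟦ t ⟧ _∙_ ρ)

  module _ (idem : Idempotent _≡_ _∙_) where

    ⟦⟧-const : ∀ {n} (t : Term n) {ρ : Fin n → A} {v} → (∀ {i} → i ∈ leaves t → ρ i ≡ v) → ⟦ t ⟧ _∙_ ρ ≡ v
    ⟦⟧-const (var i) h = h (here refl)
    ⟦⟧-const (s · t) {v = v} h =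
      trans (cong₂ _∙_ (⟦⟧-const s (h ∘ ∈-++⁺ˡ)) (⟦⟧-const t (h ∘ ∈-++⁺ʳ (leaves s)))) (idem v)

    module Absorbing {a b : A} (ab≡b : a ∙ b ≡ b) (ba≡b : b ∙ a ≡ b) where

      AorB : A → Set
      AorB x = x ≡ a ⊎ x ≡ b

      ∙-absorbˡ : ∀ {y} → AorB y → b ∙ y ≡ b
      ∙-absorbˡ (inj₁ refl) = ba≡b
      ∙-absorbˡ (inj₂ refl) = idem b

      ∙-absorbʳ : ∀ {x} → AorB x → x ∙ b ≡ b
      ∙-absorbʳ (inj₁ refl) = ab≡b
      ∙-absorbʳ (inj₂ refl) = idem b

      ∙-closed : ∀ {x y} → AorB x → AorB y → AorB (x ∙ y)
      ∙-closed (inj₁ refl) (inj₁ refl) = inj₁ (idem a)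
      ∙-closed (inj₁ refl) (inj₂ refl) = inj₂ ab≡b
      ∙-closed (inj₂ refl) y∈ab        = inj₂ (∙-absorbˡ y∈ab)

      ⟦⟧-closed : ∀ {n} (t : Term n) {ρ : Fin n → A} → (∀ {i} → i ∈ leaves t → AorB (ρ i)) → AorB (⟦ t ⟧ _∙_ ρ)
      ⟦⟧-closed (var i) h = h (here refl)
      ⟦⟧-closed (s · t) h = ∙-closed (⟦⟧-closed s (h ∘ ∈-++⁺ˡ)) (⟦⟧-closed t (h ∘ ∈-++⁺ʳ (leaves s)))

      ⟦⟧-absorbed : ∀ {n} (t : Term n) {ρ : Fin n → A} {j} → (∀ {i} → i ∈ leaves t → AorB (ρ i)) →
                    j ∈ leaves t → ρ j ≡ b → ⟦ t ⟧ _∙_ ρ ≡ b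
      ⟦⟧-absorbed (var i) h (here refl) ρj≡b = ρj≡b
      ⟦⟧-absorbed (s · t) h j∈ ρj≡b with ∈-++⁻ (leaves s) j∈
      ... | inj₁ j∈s = trans (cong (_∙ _) (⟦⟧-absorbed s (h ∘ ∈-++⁺ˡ) j∈s ρj≡b))
                             (∙-absorbˡ (⟦⟧-closed t (h ∘ ∈-++⁺ʳ (leaves s))))
      ... | inj₂ j∈t = trans (cong (_ ∙_) (⟦⟧-absorbed t (h ∘ ∈-++⁺ʳ (leaves s)) j∈t ρj≡b))
                             (∙-absorbʳ (⟦⟧-closed s (h ∘ ∈-++⁺ˡ)))

_∈ᶠ?_ : ∀ {n} (i : Fin n) (S : List (Fin n)) → Dec (i ∈ S)
i ∈ᶠ? S = any? (i ≟ᶠ_) S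

override : ∀ {A : Set} {n} → (Fin n → A) → List (Fin n) → A → Fin n → A
override ρ S v i with i ∈ᶠ? S
... | yes _ = v
... | no  _ = ρ i

override-∈ : ∀ {A : Set} {n} (ρ : Fin n → A) S v {i} → i ∈ S → override ρ S v i ≡ v
override-∈ ρ S v {i} i∈S with i ∈ᶠ? S
... | yes _   = refl
... | no  i∉S = ⊥-elim (i∉S i∈S)

override-∉ : ∀ {A : Set} {n} (ρ : Fin n → A) S v {i} → i ∉ S → override ρ S v i ≡ ρ i
override-∉ ρ S v {i} i∉S with i ∈ᶠ? S
... | yes i∈S = ⊥-elim (i∉S i∈S)
... | no  _   = refl

numDistinctOps : ∀ {A : Set} (_∙_ : A → A → A) {n} (P : Term n → Set) (G : List (Term n)) →
                 All P G → AllPairs (λ s t → ¬ (⟦ s ⟧ _∙_ ≗ ⟦ t ⟧ _∙_)) G →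
                 (∀ t → P t → ∃ λ s → s ∈ G × ⟦ s ⟧ _∙_ ≗ ⟦ t ⟧ _∙_) → NumDistinctOps _∙_ n P (length G)
numDistinctOps _∙_ P G all-P distinct covered =
    map (λ t → ⟦ t ⟧ _∙_) G
  , length-map _ G
  , AllPairs.map⁺ distinct
  , All.map⁺ (All.map (λ {t} pt → t , pt , λ _ → refl) all-P)
  , λ t pt → let s , s∈G , e = covered t pt in Any.map⁺ (Any.map (λ { refl → e }) s∈G)

FullLinear⇒Unique : ∀ {n} (t : Term n) → FullLinear t → Unique (leaves t)
FullLinear⇒Unique {n} t fl = Unique-resp-↭ (↭-sym fl) (allFin⁺ n)

FullLinear⇒∈ : ∀ {n} (t : Term n) → FullLinear t → ∀ i → i ∈ leaves t
FullLinear⇒∈ t fl i = ∈-resp-↭ (↭-sym fl) (∈-allFin i)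

Unique∧∈⇒FullLinear : ∀ {n} (t : Term n) → Unique (leaves t) → (∀ i → i ∈ leaves t) → FullLinear t
Unique∧∈⇒FullLinear {n} t u all∈ =
  ∼bag⇒↭ (unique∧set⇒bag u (allFin⁺ n) (λ {i} → mk⇔ (λ _ → ∈-allFin i) (λ _ → all∈ i)))

-- Canonical forms for commutative operations

minLeaf : ∀ {n} → Term n → ℕ
minLeaf (var i) = toℕ i
minLeaf (s · t) = minLeaf s ⊓ minLeaf t

minLeaf-∈ : ∀ {n} (t : Term n) → ∃ λ i → i ∈ leaves t × toℕ i ≡ minLeaf t
minLeaf-∈ (var i) = i , here refl , refl
minLeaf-∈ (s · t) with ⊓-sel (minLeaf s) (minLeaf t) | minLeaf-∈ s | minLeaf-∈ t
... | inj₁ s⊓t≡s | i , i∈s , i≡s | _             = i , ∈-++⁺ˡ i∈s , trans i≡s (sym s⊓t≡s)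
... | inj₂ s⊓t≡t | _             | i , i∈t , i≡t = i , ∈-++⁺ʳ (leaves s) i∈t , trans i≡t (sym s⊓t≡t)

#⇒minLeaf-≢ : ∀ {n} (a b : Term n) → Disjoint (leaves a) (leaves b) → minLeaf a ≢ minLeaf b
#⇒minLeaf-≢ a b a#b a≡b with minLeaf-∈ a | minLeaf-∈ b
... | i , i∈a , i≡a | j , j∈b , j≡b =
  a#b (i∈a , subst (_∈ leaves b) (toℕ-injective (trans j≡b (trans (sym a≡b) (sym i≡a)))) j∈b)

orient : ∀ {n} → Term n → Term n → Term n
orient a b with minLeaf a <? minLeaf b
... | yes _ = a · b
... | no  _ = b · a

canon : ∀ {n} → Term n → Term n
canon (var i) = var i
canon (s · t) = orient (canon s) (canon t)

data Canonical {n} : Term n → Set where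
  var  : ∀ i → Canonical (var i)
  node : ∀ {a b} → Canonical a → Canonical b → minLeaf a < minLeaf b → Canonical (a · b)

orient-< : ∀ {n} {a b : Term n} → minLeaf a < minLeaf b → orient a b ≡ a · b
orient-< {a = a} {b} a<b with minLeaf a <? minLeaf b
... | yes _   = refl
... | no  a≮b = ⊥-elim (a≮b a<b)

orient-comm : ∀ {n} (a b : Term n) → minLeaf a ≢ minLeaf b → orient a b ≡ orient b a
orient-comm a b a≢b with minLeaf a <? minLeaf b | minLeaf b <? minLeaf a
... | yes a<b | yes b<a = ⊥-elim (<-asym a<b b<a)
... | yes _   | no  _   = refl
... | no  _   | yes _   = refl
... | no  a≮b | no  b≮a = ⊥-elim (a≢b (≤-antisym (≮⇒≥ b≮a) (≮⇒≥ a≮b)))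

minLeaf-orient : ∀ {n} (a b : Term n) → minLeaf (orient a b) ≡ minLeaf a ⊓ minLeaf b
minLeaf-orient a b with minLeaf a <? minLeaf b
... | yes _ = refl
... | no  _ = ⊓-comm (minLeaf b) (minLeaf a)

leaves-orient : ∀ {n} (a b : Term n) → leaves (orient a b) ↭ leaves a ++ leaves b
leaves-orient a b with minLeaf a <? minLeaf b
... | yes _ = ↭-refl
... | no  _ = ++-comm (leaves b) (leaves a)

⟦orient⟧ : ∀ {A : Set} (_∙_ : A → A → A) → Commutative _≡_ _∙_ →
           ∀ {n} (a b : Term n) → ⟦ orient a b ⟧ _∙_ ≗ ⟦ a · b ⟧ _∙_
⟦orient⟧ _∙_ comm a b ρ with minLeaf a <? minLeaf b
... | yes _ = refl
... | no  _ = ⟦⟧-comm _∙_ comm b a ρ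

Canonical-orient : ∀ {n} {a b : Term n} → Canonical a → Canonical b → minLeaf a ≢ minLeaf b →
                   Canonical (orient a b)
Canonical-orient {a = a} {b} ca cb a≢b with minLeaf a <? minLeaf b
... | yes a<b = node ca cb a<b
... | no  a≮b = node cb ca (≤∧≢⇒< (≮⇒≥ a≮b) (a≢b ∘ sym))

minLeaf-canon : ∀ {n} (t : Term n) → minLeaf (canon t) ≡ minLeaf t
minLeaf-canon (var i) = refl
minLeaf-canon (s · t) =
  trans (minLeaf-orient (canon s) (canon t)) (cong₂ _⊓_ (minLeaf-canon s) (minLeaf-canon t))

leaves-canon : ∀ {n} (t : Term n) → leaves (canon t) ↭ leaves t
leaves-canon (var i) = ↭-refl
leaves-canon (s · t) = ↭-trans (leaves-orient (canon s) (canon t)) (++⁺ (leaves-canon s) (leaves-canon t))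

⟦canon⟧ : ∀ {A : Set} (_∙_ : A → A → A) → Commutative _≡_ _∙_ → ∀ {n} (t : Term n) → ⟦ canon t ⟧ _∙_ ≗ ⟦ t ⟧ _∙_
⟦canon⟧ _∙_ comm (var i) ρ = refl
⟦canon⟧ _∙_ comm (s · t) ρ =
  trans (⟦orient⟧ _∙_ comm (canon s) (canon t) ρ) (cong₂ _∙_ (⟦canon⟧ _∙_ comm s ρ) (⟦canon⟧ _∙_ comm t ρ))

canon-Canonical : ∀ {n} (t : Term n) → Unique (leaves t) → Canonical (canon t)
canon-Canonical (var i) _ = var i
canon-Canonical (s · t) u with Unique-++⁻ (leaves s) u
... | us , ut , s#t = Canonical-orient (canon-Canonical s us) (canon-Canonical t ut)
  λ eq → #⇒minLeaf-≢ s t s#t (trans (sym (minLeaf-canon s)) (trans eq (minLeaf-canon t)))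

Canonical⇒canon≡ : ∀ {n} {t : Term n} → Canonical t → canon t ≡ t
Canonical⇒canon≡ (var i) = refl
Canonical⇒canon≡ (node {a} {b} ca cb a<b)
  rewrite Canonical⇒canon≡ ca | Canonical⇒canon≡ cb = orient-< a<b

CanonicalLinear : ∀ {n} → Term n → Set
CanonicalLinear t = FullLinear t × Canonical t

canon-CanonicalLinear : ∀ {n} (t : Term n) → FullLinear t → CanonicalLinear (canon t)
canon-CanonicalLinear t fl = ↭-trans (leaves-canon t) fl , canon-Canonical t (FullLinear⇒Unique t fl)

rename : ∀ {m n} → (Fin m → Fin n) → Term m → Term n
rename f (var i) = var (f i)
rename f (s · t) = rename f s · rename f t

leaves-rename : ∀ {m n} (f : Fin m → Fin n) (t : Term m) → leaves (rename f t) ≡ map f (leaves t)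
leaves-rename f (var i) = refl
leaves-rename f (s · t) =
  trans (cong₂ _++_ (leaves-rename f s) (leaves-rename f t)) (sym (map-++ f (leaves s) (leaves t)))

rename-injective : ∀ {m n} {f : Fin m → Fin n} → (∀ {i j} → f i ≡ f j → i ≡ j) →
                   ∀ {s t} → rename f s ≡ rename f t → s ≡ t
rename-injective f-inj {var i} {var j}   eq = cong var (f-inj (var-injective eq))
rename-injective f-inj {s · t} {s′ · t′} eq =
  cong₂ _·_ (rename-injective f-inj (·-injectiveˡ eq)) (rename-injective f-inj (·-injectiveʳ eq))

module _ {m n} {f : Fin m → Fin n} (toℕ-f : ∀ i → toℕ (f i) ≡ toℕ i) where

  minLeaf-rename : ∀ t → minLeaf (rename f t) ≡ minLeaf t
  minLeaf-rename (var i) = toℕ-f i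
  minLeaf-rename (s · t) = cong₂ _⊓_ (minLeaf-rename s) (minLeaf-rename t)

  Canonical-rename⁺ : ∀ {t} → Canonical t → Canonical (rename f t)
  Canonical-rename⁺ (var i) = var (f i)
  Canonical-rename⁺ (node {a} {b} ca cb a<b) =
    node (Canonical-rename⁺ ca) (Canonical-rename⁺ cb)
         (subst₂ _<_ (sym (minLeaf-rename a)) (sym (minLeaf-rename b)) a<b)

  Canonical-rename⁻ : ∀ t → Canonical (rename f t) → Canonical t
  Canonical-rename⁻ (var i) _ = var i
  Canonical-rename⁻ (a · b) (node ca cb a<b) =
    node (Canonical-rename⁻ a ca) (Canonical-rename⁻ b cb)
         (subst₂ _<_ (minLeaf-rename a) (minLeaf-rename b) a<b)

-- Rock-paper-scissors operations determine canonical forms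

⟦_⟧ʳ : ∀ {n} → Term n → Op RPS n
⟦ t ⟧ʳ = ⟦ t ⟧ _*ʳ_

module RockPaper = Absorbing _*ʳ_ *ʳ-idem {rock} {paper} refl refl
module ScissorsRock = Absorbing _*ʳ_ *ʳ-idem {scissors} {rock} refl refl

probe : ∀ {n} → Fin n → List (Fin n) → Fin n → RPS
probe j S = override (override (λ _ → rock) S scissors) (j ∷ []) paper

≢⇒∉-singleton : ∀ {A : Set} {i j : A} → i ≢ j → i ∉ j ∷ []
≢⇒∉-singleton i≢j (here i≡j) = i≢j i≡j

probe-self : ∀ {n} (j : Fin n) S → probe j S j ≡ paper
probe-self j S = override-∈ _ (j ∷ []) paper (here refl)

probe-∈ : ∀ {n} (j : Fin n) S {i} → i ≢ j → i ∈ S → probe j S i ≡ scissors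
probe-∈ j S i≢j i∈S =
  trans (override-∉ _ (j ∷ []) paper (≢⇒∉-singleton i≢j)) (override-∈ _ S scissors i∈S)

probe-∉ : ∀ {n} (j : Fin n) S {i} → i ≢ j → i ∉ S → probe j S i ≡ rock
probe-∉ j S i≢j i∉S =
  trans (override-∉ _ (j ∷ []) paper (≢⇒∉-singleton i≢j)) (override-∉ _ S scissors i∉S)

probe-rock-paper : ∀ {n} (j : Fin n) S {i} → i ∉ S → RockPaper.AorB (probe j S i)
probe-rock-paper j S {i} i∉S = by-cases (i ≟ᶠ j)
  where
  by-cases : Dec (i ≡ j) → RockPaper.AorB (probe j S i)
  by-cases (yes refl) = inj₂ (probe-self j S)
  by-cases (no  i≢j)  = inj₁ (probe-∉ j S i≢j i∉S)

probe-scissors-rock : ∀ {n} {j : Fin n} S {i} → i ≢ j → ScissorsRock.AorB (probe j S i)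
probe-scissors-rock {j = j} S {i} i≢j = by-cases (i ∈ᶠ? S)
  where
  by-cases : Dec (i ∈ S) → ScissorsRock.AorB (probe j S i)
  by-cases (yes i∈S) = inj₁ (probe-∈ j S i≢j i∈S)
  by-cases (no  i∉S) = inj₂ (probe-∉ j S i≢j i∉S)

#⇒≢ : ∀ {n} {xs ys : List (Fin n)} {i j} → Disjoint xs ys → j ∈ xs → i ∈ ys → i ≢ j
#⇒≢ xs#ys j∈xs i∈ys refl = xs#ys (j∈xs , i∈ys)

⟦⟧ʳ-probe≡scissors : ∀ {n} (w₁ w₂ : Term n) {j} → Disjoint (leaves w₁) (leaves w₂) → j ∈ leaves w₁ →
                     ⟦ w₁ · w₂ ⟧ʳ (probe j (leaves w₂)) ≡ scissors
⟦⟧ʳ-probe≡scissors w₁ w₂ {j} w₁#w₂ j∈w₁ =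
  cong₂ _*ʳ_ (RockPaper.⟦⟧-absorbed w₁ (λ i∈w₁ → probe-rock-paper j (leaves w₂) λ i∈w₂ → w₁#w₂ (i∈w₁ , i∈w₂))
                                      j∈w₁ (probe-self j (leaves w₂)))
             (⟦⟧-const _*ʳ_ *ʳ-idem w₂ λ i∈w₂ → probe-∈ j (leaves w₂) (#⇒≢ w₁#w₂ j∈w₁ i∈w₂) i∈w₂)

⟦⟧ʳ-probe≢scissors : ∀ {n} (w₁ w₂ : Term n) {j k S} → Disjoint (leaves w₁) (leaves w₂) →
                     j ∈ leaves w₁ → k ∈ leaves w₂ → k ∉ S → ⟦ w₁ · w₂ ⟧ʳ (probe j S) ≢ scissors
⟦⟧ʳ-probe≢scissors w₁ w₂ {j} {S = S} w₁#w₂ j∈w₁ k∈w₂ k∉S eq =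
  x*ʳrock≢scissors (⟦ w₁ ⟧ʳ (probe j S)) (subst (λ z → ⟦ w₁ ⟧ʳ (probe j S) *ʳ z ≡ scissors) ⟦w₂⟧≡rock eq)
  where
  ⟦w₂⟧≡rock : ⟦ w₂ ⟧ʳ (probe j S) ≡ rock
  ⟦w₂⟧≡rock = ScissorsRock.⟦⟧-absorbed w₂
                (λ {i} i∈w₂ → probe-scissors-rock {j = j} S {i} (#⇒≢ w₁#w₂ j∈w₁ i∈w₂))
                k∈w₂ (probe-∉ j S (#⇒≢ w₁#w₂ j∈w₁ k∈w₂) k∉S)

⟦⟧ʳ-≗⇒⊇ : ∀ {n} (t u : Term n) → ⟦ t ⟧ʳ ≗ ⟦ u ⟧ʳ → leaves u ⊆ leaves t
⟦⟧ʳ-≗⇒⊇ t u e {x} x∈u with x ∈ᶠ? leaves t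
... | yes x∈t = x∈t
... | no  x∉t = ⊥-elim (rock≢paper (begin
  rock                 ≡⟨ ⟦⟧-const _*ʳ_ *ʳ-idem t (λ {i} i∈t → probe-∉ x [] {i} (λ { refl → x∉t i∈t }) λ ()) ⟨
  ⟦ t ⟧ʳ (probe x [])  ≡⟨ e (probe x []) ⟩
  ⟦ u ⟧ʳ (probe x [])  ≡⟨ RockPaper.⟦⟧-absorbed u (λ {i} _ → probe-rock-paper x [] {i} λ ()) x∈u (probe-self x []) ⟩
  paper                ∎))
  where
  open ≡-Reasoning
  rock≢paper : rock ≢ paper
  rock≢paper ()

-- Under probe i (leaves t₂) the left-hand side evaluates to scissors, so no variable of u₂ may lie outside t₂.
⟦·⟧ʳ-≗⇒⊆ʳ : ∀ {n} (t₁ t₂ u₁ u₂ : Term n) {i} → Disjoint (leaves t₁) (leaves t₂) →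
            Disjoint (leaves u₁) (leaves u₂) → ⟦ t₁ · t₂ ⟧ʳ ≗ ⟦ u₁ · u₂ ⟧ʳ → i ∈ leaves t₁ → i ∈ leaves u₁ → leaves u₂ ⊆ leaves t₂
⟦·⟧ʳ-≗⇒⊆ʳ t₁ t₂ u₁ u₂ t₁#t₂ u₁#u₂ e i∈t₁ i∈u₁ {x} x∈u₂ with x ∈ᶠ? leaves t₂
... | yes x∈t₂ = x∈t₂
... | no  x∉t₂ = ⊥-elim (⟦⟧ʳ-probe≢scissors u₁ u₂ u₁#u₂ i∈u₁ x∈u₂ x∉t₂
                          (trans (sym (e _)) (⟦⟧ʳ-probe≡scissors t₁ t₂ t₁#t₂ i∈t₁)))

-- Freezing the variables of a₂ at v leaves ⟦ a₁ ⟧ ρ * v ≡ ⟦ b₁ ⟧ ρ * v, and v = rock, paper separate all values.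
⟦·⟧ʳ-≗⇒≗ˡ : ∀ {n} (a₁ a₂ b₁ b₂ : Term n) → Disjoint (leaves a₁) (leaves a₂) →
            leaves b₁ ⊆ leaves a₁ → leaves b₂ ⊆ leaves a₂ → ⟦ a₁ · a₂ ⟧ʳ ≗ ⟦ b₁ · b₂ ⟧ʳ → ⟦ a₁ ⟧ʳ ≗ ⟦ b₁ ⟧ʳ
⟦·⟧ʳ-≗⇒≗ˡ a₁ a₂ b₁ b₂ a₁#a₂ b₁⊆a₁ b₂⊆a₂ e ρ =
  *ʳ-cancelʳ-rock-paper _ _ (frozen rock) (frozen paper)
  where
  frozen : ∀ v → ⟦ a₁ ⟧ʳ ρ *ʳ v ≡ ⟦ b₁ ⟧ʳ ρ *ʳ v
  frozen v = begin
    ⟦ a₁ ⟧ʳ ρ *ʳ v   ≡⟨ sym (cong₂ _*ʳ_ (unfrozen a₁ λ i∈a₁ i∈a₂ → a₁#a₂ (i∈a₁ , i∈a₂))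
                                        (⟦⟧-const _*ʳ_ *ʳ-idem a₂ (override-∈ ρ _ v))) ⟩
    ⟦ a₁ · a₂ ⟧ʳ ρ′  ≡⟨ e ρ′ ⟩
    ⟦ b₁ · b₂ ⟧ʳ ρ′  ≡⟨ cong₂ _*ʳ_ (unfrozen b₁ λ i∈b₁ i∈a₂ → a₁#a₂ (b₁⊆a₁ i∈b₁ , i∈a₂))
                                  (⟦⟧-const _*ʳ_ *ʳ-idem b₂ (override-∈ ρ _ v ∘ b₂⊆a₂)) ⟩
    ⟦ b₁ ⟧ʳ ρ *ʳ v   ∎
    where
    open ≡-Reasoning
    ρ′ = override ρ (leaves a₂) v
    unfrozen : ∀ w → (∀ {i} → i ∈ leaves w → i ∉ leaves a₂) → ⟦ w ⟧ʳ ρ′ ≡ ⟦ w ⟧ʳ ρ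
    unfrozen w outside = ⟦⟧-cong-leaves _*ʳ_ w λ i∈w → override-∉ ρ _ v (outside i∈w)

⟦·⟧ʳ-≗⇒≗-children : ∀ {n} (t₁ t₂ u₁ u₂ : Term n) {i} → Disjoint (leaves t₁) (leaves t₂) →
                    Disjoint (leaves u₁) (leaves u₂) → ⟦ t₁ · t₂ ⟧ʳ ≗ ⟦ u₁ · u₂ ⟧ʳ →
                    i ∈ leaves t₁ → i ∈ leaves u₁ → ⟦ t₁ ⟧ʳ ≗ ⟦ u₁ ⟧ʳ × ⟦ t₂ ⟧ʳ ≗ ⟦ u₂ ⟧ʳ
⟦·⟧ʳ-≗⇒≗-children t₁ t₂ u₁ u₂ t₁#t₂ u₁#u₂ e i∈t₁ i∈u₁ =
  ⟦·⟧ʳ-≗⇒≗ˡ t₁ t₂ u₁ u₂ t₁#t₂ u₁⊆t₁ u₂⊆t₂ e , ⟦·⟧ʳ-≗⇒≗ˡ t₂ t₁ u₂ u₁ (Disjoint.sym t₁#t₂) u₂⊆t₂ u₁⊆t₁ e′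
  where
  e′ : ⟦ t₂ · t₁ ⟧ʳ ≗ ⟦ u₂ · u₁ ⟧ʳ
  e′ ρ = trans (⟦⟧-comm _*ʳ_ *ʳ-comm t₂ t₁ ρ) (trans (e ρ) (⟦⟧-comm _*ʳ_ *ʳ-comm u₁ u₂ ρ))
  u₂⊆t₂ : leaves u₂ ⊆ leaves t₂
  u₂⊆t₂ = ⟦·⟧ʳ-≗⇒⊆ʳ t₁ t₂ u₁ u₂ t₁#t₂ u₁#u₂ e i∈t₁ i∈u₁
  u₁⊆t₁ : leaves u₁ ⊆ leaves t₁
  u₁⊆t₁ = let j , j∈u₂ = leaf-∃ u₂ in
          ⟦·⟧ʳ-≗⇒⊆ʳ t₂ t₁ u₂ u₁ (Disjoint.sym t₁#t₂) (Disjoint.sym u₁#u₂) e′ (u₂⊆t₂ j∈u₂) j∈u₂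

var≉· : ∀ {n} (i : Fin n) u₁ u₂ → Disjoint (leaves u₁) (leaves u₂) → ¬ (⟦ var i ⟧ʳ ≗ ⟦ u₁ · u₂ ⟧ʳ)
var≉· i u₁ u₂ u₁#u₂ e with leaf-∃ u₁ | leaf-∃ u₂
... | a , a∈u₁ | b , b∈u₂
  with ⟦⟧ʳ-≗⇒⊇ (var i) (u₁ · u₂) e (∈-++⁺ˡ a∈u₁) | ⟦⟧ʳ-≗⇒⊇ (var i) (u₁ · u₂) e (∈-++⁺ʳ (leaves u₁) b∈u₂)
... | here refl | here refl = u₁#u₂ (a∈u₁ , b∈u₂)

canon-≗ : ∀ {n} (t u : Term n) → Unique (leaves t) → Unique (leaves u) → ⟦ t ⟧ʳ ≗ ⟦ u ⟧ʳ → canon t ≡ canon u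
canon-≗ (var i) (var j) _ _ e with ⟦⟧ʳ-≗⇒⊇ (var i) (var j) e {j} (here refl)
... | here refl = refl
canon-≗ (var i) (u₁ · u₂) _ uu e = ⊥-elim (var≉· i u₁ u₂ (proj₂ (proj₂ (Unique-++⁻ (leaves u₁) uu))) e)
canon-≗ (t₁ · t₂) (var j) ut _ e = ⊥-elim (var≉· j t₁ t₂ (proj₂ (proj₂ (Unique-++⁻ (leaves t₁) ut))) (sym ∘ e))
canon-≗ (t₁ · t₂) (u₁ · u₂) ut uu e
  with Unique-++⁻ (leaves t₁) ut | Unique-++⁻ (leaves u₁) uu | leaf-∃ t₁
... | ut₁ , ut₂ , t₁#t₂ | uu₁ , uu₂ , u₁#u₂ | i , i∈t₁
  with ∈-++⁻ (leaves u₁) (⟦⟧ʳ-≗⇒⊇ (u₁ · u₂) (t₁ · t₂) (sym ∘ e) (∈-++⁺ˡ i∈t₁))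
... | inj₁ i∈u₁ =
  let e₁ , e₂ = ⟦·⟧ʳ-≗⇒≗-children t₁ t₂ u₁ u₂ t₁#t₂ u₁#u₂ e i∈t₁ i∈u₁
  in cong₂ orient (canon-≗ t₁ u₁ ut₁ uu₁ e₁) (canon-≗ t₂ u₂ ut₂ uu₂ e₂)
... | inj₂ i∈u₂ =
  let e₁ , e₂ = ⟦·⟧ʳ-≗⇒≗-children t₁ t₂ u₂ u₁ t₁#t₂ (Disjoint.sym u₁#u₂)
                  (λ ρ → trans (e ρ) (⟦⟧-comm _*ʳ_ *ʳ-comm u₁ u₂ ρ)) i∈t₁ i∈u₂
  in trans (cong₂ orient (canon-≗ t₁ u₂ ut₁ uu₂ e₁) (canon-≗ t₂ u₁ ut₂ uu₁ e₂))
           (orient-comm (canon u₂) (canon u₁) λ eq →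
              #⇒minLeaf-≢ u₁ u₂ u₁#u₂ (trans (sym (minLeaf-canon u₁)) (trans (sym eq) (minLeaf-canon u₂))))

Canonical-≗⇒≡ : ∀ {n} {t u : Term n} → Canonical t → Canonical u →
                Unique (leaves t) → Unique (leaves u) → ⟦ t ⟧ʳ ≗ ⟦ u ⟧ʳ → t ≡ u
Canonical-≗⇒≡ {t = t} {u} ct cu ut uu e =
  trans (sym (Canonical⇒canon≡ ct)) (trans (canon-≗ t u ut uu e) (Canonical⇒canon≡ cu))

CanonicalLinear-distinctOps : ∀ {n} {G : List (Term n)} → All CanonicalLinear G → Unique G →
                              AllPairs (λ s t → ¬ (⟦ s ⟧ʳ ≗ ⟦ t ⟧ʳ)) G
CanonicalLinear-distinctOps = Unique⇒AllPairs-¬ λ {s} {t} (fs , cs) (ft , ct) →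
  Canonical-≗⇒≡ cs ct (FullLinear⇒Unique s fs) (FullLinear⇒Unique t ft)

-- Canonical full linear terms

module Insertion {N} (X : Fin N) (X-max : ∀ {i} → i ≢ X → toℕ i < toℕ X) where

  data Insert : Term N → Term N → Set where
    top   : ∀ {w} → Insert w (w · var X)
    left  : ∀ {a a′ b} → Insert a a′ → Insert (a · b) (a′ · b)
    right : ∀ {a b b′} → Insert b b′ → Insert (a · b) (a · b′)

  mutual
    insertions : Term N → List (Term N)
    insertions w = w · var X ∷ insertionsBelow w

    insertionsBelow : Term N → List (Term N)
    insertionsBelow (var i) = []
    insertionsBelow (a · b) = map (_· b) (insertions a) ++ map (a ·_) (insertions b)

  mutual
    ∈-insertions⁻ : ∀ {w e} → e ∈ insertions w → Insert w e
    ∈-insertions⁻ (here refl) = top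
    ∈-insertions⁻ (there e∈) = ∈-insertionsBelow⁻ e∈

    ∈-insertionsBelow⁻ : ∀ {w e} → e ∈ insertionsBelow w → Insert w e
    ∈-insertionsBelow⁻ {a · b} e∈ with ∈-++⁻ (map (_· b) (insertions a)) e∈
    ... | inj₁ e∈ˡ = let a′ , a′∈ , e≡ = ∈-map⁻ (_· b) e∈ˡ in subst (Insert _) (sym e≡) (left (∈-insertions⁻ a′∈))
    ... | inj₂ e∈ʳ = let b′ , b′∈ , e≡ = ∈-map⁻ (a ·_) e∈ʳ in subst (Insert _) (sym e≡) (right (∈-insertions⁻ b′∈))

  ∈-insertions⁺ : ∀ {w e} → Insert w e → e ∈ insertions w
  ∈-insertions⁺ top = here refl
  ∈-insertions⁺ (left {a} {b = b} p) =
    there (∈-++⁺ˡ (∈-map⁺ (_· b) (∈-insertions⁺ p)))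
  ∈-insertions⁺ (right {a} {b} p) =
    there (∈-++⁺ʳ (map (_· b) (insertions a)) (∈-map⁺ (a ·_) (∈-insertions⁺ p)))

  Insert-≢var : ∀ {w e i} → Insert w e → e ≢ var i
  Insert-≢var top       ()
  Insert-≢var (left _)  ()
  Insert-≢var (right _) ()

  X∈Insert : ∀ {w e} → Insert w e → X ∈ leaves e
  X∈Insert (top {w})       = ∈-++⁺ʳ (leaves w) (here refl)
  X∈Insert (left p)        = ∈-++⁺ˡ (X∈Insert p)
  X∈Insert (right {a} p)   = ∈-++⁺ʳ (leaves a) (X∈Insert p)

  leaves-Insert : ∀ {w e} → Insert w e → leaves e ↭ leaves w ++ X ∷ []
  leaves-Insert top = ↭-refl
  leaves-Insert (left {a} {a′} {b} p) = begin
    leaves a′ ++ leaves b           ↭⟨ ++⁺ʳ (leaves b) (leaves-Insert p) ⟩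
    (leaves a ++ X ∷ []) ++ leaves b ≡⟨ ++-assoc (leaves a) (X ∷ []) (leaves b) ⟩
    leaves a ++ X ∷ leaves b        ↭⟨ shift X (leaves a) (leaves b) ⟩
    X ∷ leaves a ++ leaves b        ↭⟨ ++-comm (X ∷ []) (leaves a ++ leaves b) ⟩
    (leaves a ++ leaves b) ++ X ∷ [] ∎
    where open PermutationReasoning
  leaves-Insert (right {a} {b} {b′} p) = begin
    leaves a ++ leaves b′            ↭⟨ ++⁺ˡ (leaves a) (leaves-Insert p) ⟩
    leaves a ++ leaves b ++ X ∷ []   ≡⟨ ++-assoc (leaves a) (leaves b) (X ∷ []) ⟨
    (leaves a ++ leaves b) ++ X ∷ [] ∎
    where open PermutationReasoning

  minLeaf<X : ∀ w → X ∉ leaves w → minLeaf w < toℕ X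
  minLeaf<X w X∉w = let i , i∈w , i≡w = minLeaf-∈ w in
    subst (_< toℕ X) i≡w (X-max λ { refl → X∉w i∈w })

  Canonical-Insert : ∀ {w e} → Canonical w → X ∉ leaves w → Insert w e → Canonical e × minLeaf e ≡ minLeaf w
  Canonical-Insert {w} cw X∉w top = node cw (var X) (minLeaf<X w X∉w) , m≤n⇒m⊓n≡m (<⇒≤ (minLeaf<X w X∉w))
  Canonical-Insert (node {b = b} ca cb a<b) X∉w (left p) =
    let ca′ , a′≡a = Canonical-Insert ca (X∉w ∘ ∈-++⁺ˡ) p
    in node ca′ cb (subst (_< minLeaf b) (sym a′≡a) a<b) , cong (_⊓ minLeaf b) a′≡a
  Canonical-Insert (node {a} ca cb a<b) X∉w (right p) =
    let cb′ , b′≡b = Canonical-Insert cb (X∉w ∘ ∈-++⁺ʳ (leaves a)) p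
    in node ca cb′ (subst (minLeaf a <_) (sym b′≡b) a<b) , cong (minLeaf a ⊓_) b′≡b

  CanonicalSource : Term N → Set
  CanonicalSource e = ∃ λ w → Insert w e × Canonical w × X ∉ leaves w

  mutual
    Insert-complete : ∀ {e} → Canonical e → Unique (leaves e) → X ∈ leaves e → e ≢ var X → CanonicalSource e
    Insert-complete (var i) _ (here refl) e≢X = ⊥-elim (e≢X refl)
    Insert-complete (node {a} ca cb a<b) u X∈e _ with ∈-++⁻ (leaves a) X∈e
    ... | inj₁ X∈a = Insert-completeˡ ca cb a<b u X∈a
    ... | inj₂ X∈b = Insert-completeʳ ca cb a<b u X∈b

    Insert-completeˡ : ∀ {a b} → Canonical a → Canonical b → minLeaf a < minLeaf b →
                       Unique (leaves (a · b)) → X ∈ leaves a → CanonicalSource (a · b)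
    Insert-completeˡ {a} {b} (var _) cb a<b u (here refl) =
      let _ , _ , a#b = Unique-++⁻ (leaves a) u
      in ⊥-elim (<-asym a<b (minLeaf<X b λ X∈b → a#b (here refl , X∈b)))
    Insert-completeˡ {a} {b} ca@(node _ _ _) cb a<b u X∈a =
      let ua , _ , a#b = Unique-++⁻ (leaves a) u
          wa , p , cwa , X∉wa = Insert-complete ca ua X∈a λ ()
          _ , a≡wa = Canonical-Insert cwa X∉wa p
      in wa · b , left p , node cwa cb (subst (_< minLeaf b) a≡wa a<b) ,
         ∉-++⁺ X∉wa λ X∈b → a#b (X∈a , X∈b)

    Insert-completeʳ : ∀ {a b} → Canonical a → Canonical b → minLeaf a < minLeaf b →
                       Unique (leaves (a · b)) → X ∈ leaves b → CanonicalSource (a · b)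
    Insert-completeʳ {a} {b} ca (var _) a<b u (here refl) =
      let _ , _ , a#b = Unique-++⁻ (leaves a) u
      in a , top , ca , λ X∈a → a#b (X∈a , here refl)
    Insert-completeʳ {a} {b} ca cb@(node _ _ _) a<b u X∈b =
      let _ , ub , a#b = Unique-++⁻ (leaves a) u
          wb , p , cwb , X∉wb = Insert-complete cb ub X∈b λ ()
          _ , b≡wb = Canonical-Insert cwb X∉wb p
      in a · wb , right p , node ca cwb (subst (minLeaf a <_) b≡wb a<b) ,
         ∉-++⁺ (λ X∈a → a#b (X∈a , X∈b)) X∉wb

  maybe· : Maybe (Term N) → Maybe (Term N) → Maybe (Term N)
  maybe· nothing  r        = r
  maybe· (just a) nothing  = just a
  maybe· (just a) (just b) = just (a · b)

  erase : Term N → Maybe (Term N)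
  erase (var i) with i ≟ᶠ X
  ... | yes _ = nothing
  ... | no  _ = just (var i)
  erase (a · b) = maybe· (erase a) (erase b)

  erase-X : erase (var X) ≡ nothing
  erase-X with X ≟ᶠ X
  ... | yes _   = refl
  ... | no  X≢X = ⊥-elim (X≢X refl)

  erase-∉ : ∀ w → X ∉ leaves w → erase w ≡ just w
  erase-∉ (var i) X∉w with i ≟ᶠ X
  ... | yes refl = ⊥-elim (X∉w (here refl))
  ... | no  _    = refl
  erase-∉ (a · b) X∉w
    rewrite erase-∉ a (X∉w ∘ ∈-++⁺ˡ) | erase-∉ b (X∉w ∘ ∈-++⁺ʳ (leaves a)) = refl

  erase-Insert : ∀ {w e} → X ∉ leaves w → Insert w e → erase e ≡ just w
  erase-Insert {w} X∉w top rewrite erase-∉ w X∉w | erase-X = refl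
  erase-Insert {a · b} X∉w (left p)
    rewrite erase-Insert (X∉w ∘ ∈-++⁺ˡ) p | erase-∉ b (X∉w ∘ ∈-++⁺ʳ (leaves a)) = refl
  erase-Insert {a · b} X∉w (right p)
    rewrite erase-∉ a (X∉w ∘ ∈-++⁺ˡ) | erase-Insert (X∉w ∘ ∈-++⁺ʳ (leaves a)) p = refl

  Insert-injective : ∀ {w w′ e} → X ∉ leaves w → X ∉ leaves w′ → Insert w e → Insert w′ e → w ≡ w′
  Insert-injective X∉w X∉w′ p p′ = just-injective (trans (sym (erase-Insert X∉w p)) (erase-Insert X∉w′ p′))

  top∉insertionsBelow : ∀ w → X ∉ leaves w → w · var X ∉ insertionsBelow w
  top∉insertionsBelow (a · b) X∉w e∈ with ∈-++⁻ (map (_· b) (insertions a)) e∈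
  ... | inj₁ e∈ˡ = let _ , _ , eq = ∈-map⁻ (_· b) e∈ˡ in
    X∉w (∈-++⁺ʳ (leaves a) (subst (λ v → X ∈ leaves v) (·-injectiveʳ eq) (here refl)))
  ... | inj₂ e∈ʳ = let _ , b′∈ , eq = ∈-map⁻ (a ·_) e∈ʳ in
    Insert-≢var (∈-insertions⁻ b′∈) (sym (·-injectiveʳ eq))

  mutual
    insertions-unique : ∀ w → X ∉ leaves w → Unique (insertions w)
    insertions-unique w X∉w = ¬Any⇒All¬ _ (top∉insertionsBelow w X∉w) ∷ insertionsBelow-unique w X∉w

    insertionsBelow-unique : ∀ w → X ∉ leaves w → Unique (insertionsBelow w)
    insertionsBelow-unique (var i) _   = []
    insertionsBelow-unique (a · b) X∉w =
      UniqueP.++⁺ (UniqueP.map⁺ ·-injectiveˡ (insertions-unique a X∉a))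
                  (UniqueP.map⁺ ·-injectiveʳ (insertions-unique b (X∉w ∘ ∈-++⁺ʳ (leaves a))))
                  left#right
      where
      X∉a : X ∉ leaves a
      X∉a = X∉w ∘ ∈-++⁺ˡ
      left#right : Disjoint (map (_· b) (insertions a)) (map (a ·_) (insertions b))
      left#right (v∈ˡ , v∈ʳ) =
        let a′ , a′∈ , v≡a′b = ∈-map⁻ (_· b) v∈ˡ
            _  , _   , v≡ab′ = ∈-map⁻ (a ·_) v∈ʳ
        in X∉a (subst (λ v → X ∈ leaves v) (·-injectiveˡ (trans (sym v≡a′b) v≡ab′)) (X∈Insert (∈-insertions⁻ a′∈)))

  length-insertions : ∀ w → suc (length (insertions w)) ≡ length (leaves w) + length (leaves w)
  length-insertions (var i) = refl
  length-insertions (a · b) = begin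
    suc (suc (length (map (_· b) (insertions a) ++ map (a ·_) (insertions b))))
      ≡⟨ cong (λ k → suc (suc k)) (trans (length-++ (map (_· b) (insertions a)))
                                 (cong₂ _+_ (length-map (_· b) (insertions a)) (length-map (a ·_) (insertions b)))) ⟩
    suc (suc (length (insertions a) + length (insertions b)))
      ≡⟨ cong suc (+-suc (length (insertions a)) (length (insertions b))) ⟨
    suc (length (insertions a)) + suc (length (insertions b))
      ≡⟨ cong₂ _+_ (length-insertions a) (length-insertions b) ⟩
    (La + La) + (Lb + Lb)
      ≡⟨ +-interchange La La Lb Lb ⟩
    (La + Lb) + (La + Lb)
      ≡⟨ cong (λ L → L + L) (length-++ (leaves a)) ⟨
    length (leaves (a · b)) + length (leaves (a · b)) ∎
    where
    open ≡-Reasoning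
    La = length (leaves a)
    Lb = length (leaves b)

≢fromℕ⇒≢toℕ : ∀ {n} {i : Fin (suc n)} → i ≢ fromℕ n → n ≢ toℕ i
≢fromℕ⇒≢toℕ {n} i≢X n≡i = i≢X (toℕ-injective (trans (sym n≡i) (sym (toℕ-fromℕ n))))

fromℕ-max : ∀ {n} {i : Fin (suc n)} → i ≢ fromℕ n → toℕ i < toℕ (fromℕ n)
fromℕ-max {i = i} i≢X = ≤∧≢⇒< (≤fromℕ i) (i≢X ∘ toℕ-injective)

module Extension (n : ℕ) where

  open Insertion (fromℕ n) fromℕ-max public

  lift : Term n → Term (suc n)
  lift = rename inject₁

  fromℕ∉lift : ∀ s → fromℕ n ∉ leaves (lift s)
  fromℕ∉lift s X∈ = let _ , _ , eq = ∈-map⁻ inject₁ (subst (fromℕ n ∈_) (leaves-rename inject₁ s) X∈)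
                    in fromℕ≢inject₁ eq

  lift-surjective : ∀ w → fromℕ n ∉ leaves w → ∃ λ s → lift s ≡ w
  lift-surjective (var i) X∉w =
    var (lower₁ i n≢i) , cong var (inject₁-lower₁ i n≢i)
    where
    n≢i : n ≢ toℕ i
    n≢i = ≢fromℕ⇒≢toℕ λ { refl → X∉w (here refl) }
  lift-surjective (a · b) X∉w
    with lift-surjective a (X∉w ∘ ∈-++⁺ˡ) | lift-surjective b (X∉w ∘ ∈-++⁺ʳ (leaves a))
  ... | s , refl | t , refl = s · t , refl

  FullLinear-Insert⁺ : ∀ {s e} → FullLinear s → Insert (lift s) e → FullLinear e
  FullLinear-Insert⁺ {s} {e} fl p = Unique∧∈⇒FullLinear e unique-e ∈e
    where
    unique-e : Unique (leaves e)
    unique-e = Unique-resp-↭ (↭-sym (leaves-Insert p))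
      (UniqueP.++⁺ (subst Unique (sym (leaves-rename inject₁ s))
                          (UniqueP.map⁺ inject₁-injective (FullLinear⇒Unique s fl)))
                   ([] ∷ []) λ { (X∈ , here refl) → fromℕ∉lift s X∈ })
    ∈e : ∀ i → i ∈ leaves e
    ∈e i with i ≟ᶠ fromℕ n
    ... | yes refl = X∈Insert p
    ... | no  i≢X  = ∈-resp-↭ (↭-sym (leaves-Insert p)) (∈-++⁺ˡ
      (subst (_∈ leaves (lift s)) (inject₁-lower₁ i (≢fromℕ⇒≢toℕ i≢X))
        (subst (_ ∈_) (sym (leaves-rename inject₁ s)) (∈-map⁺ inject₁ (FullLinear⇒∈ s fl _)))))

  FullLinear-Insert⁻ : ∀ {s e} → FullLinear e → Insert (lift s) e → FullLinear s
  FullLinear-Insert⁻ {s} {e} fl p = Unique∧∈⇒FullLinear s unique-s ∈s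
    where
    perm : leaves e ↭ map inject₁ (leaves s) ++ fromℕ n ∷ []
    perm = subst (λ xs → leaves e ↭ xs ++ fromℕ n ∷ []) (leaves-rename inject₁ s) (leaves-Insert p)
    unique-s : Unique (leaves s)
    unique-s = UniqueP.map⁻ (proj₁ (Unique-++⁻ (map inject₁ (leaves s))
                                               (Unique-resp-↭ perm (FullLinear⇒Unique e fl))))
    ∈s : ∀ i → i ∈ leaves s
    ∈s i with ∈-++⁻ (map inject₁ (leaves s)) (∈-resp-↭ perm (FullLinear⇒∈ e fl (inject₁ i)))
    ... | inj₁ i∈ = let _ , j∈ , i≡j = ∈-map⁻ inject₁ i∈ in subst (_∈ leaves s) (sym (inject₁-injective i≡j)) j∈
    ... | inj₂ (here i≡X) = ⊥-elim (fromℕ≢inject₁ (sym i≡X))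

  Insert-lift-sound : ∀ {s e} → FullLinear s → Canonical s → Insert (lift s) e → FullLinear e × Canonical e
  Insert-lift-sound {s} fl cs p =
    FullLinear-Insert⁺ fl p , proj₁ (Canonical-Insert (Canonical-rename⁺ toℕ-inject₁ cs) (fromℕ∉lift s) p)

  Insert-lift-complete : ∀ {e} → FullLinear e → Canonical e → e ≢ var (fromℕ n) →
                         ∃ λ s → Insert (lift s) e × FullLinear s × Canonical s
  Insert-lift-complete {e} fl ce e≢X
    with Insert-complete ce (FullLinear⇒Unique e fl) (FullLinear⇒∈ e fl (fromℕ n)) e≢X
  ... | w , p , cw , X∉w with lift-surjective w X∉w
  ... | s , refl = s , p , FullLinear-Insert⁻ fl p , Canonical-rename⁻ toℕ-inject₁ s cw

  extend : List (Term n) → List (Term (suc n))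
  extend = concatMap (insertions ∘ lift)

  extend-sound : ∀ {G} → All CanonicalLinear G → All CanonicalLinear (extend G)
  extend-sound {G} all-G = All.tabulate λ e∈ →
    let s , s∈ , e∈′ = find (∈-concatMap⁻ (insertions ∘ lift) {xs = G} e∈)
        fl , cs      = All.lookup all-G s∈
    in Insert-lift-sound fl cs (∈-insertions⁻ e∈′)

  extend-unique : ∀ {G} → Unique G → Unique (extend G)
  extend-unique unique-G =
    UniqueP.concat⁺ (All.map⁺ (All.tabulate λ {s} _ → insertions-unique (lift s) (fromℕ∉lift s)))
                    (AllPairs.map⁺ (AllPairs.map disjoint unique-G))
    where
    disjoint : ∀ {s s′} → s ≢ s′ → Disjoint (insertions (lift s)) (insertions (lift s′))
    disjoint {s} {s′} s≢s′ (e∈ , e∈′) = s≢s′ (rename-injective inject₁-injective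
      (Insert-injective (fromℕ∉lift s) (fromℕ∉lift s′) (∈-insertions⁻ e∈) (∈-insertions⁻ e∈′)))

  extend-complete : ∀ {G} → (∀ {s} → CanonicalLinear s → s ∈ G) →
                    ∀ {e} → CanonicalLinear e → e ≢ var (fromℕ n) → e ∈ extend G
  extend-complete G-complete (fl , ce) e≢X with Insert-lift-complete fl ce e≢X
  ... | s , p , fs , cs =
    ∈-concatMap⁺ (insertions ∘ lift) (Any.map (λ { refl → ∈-insertions⁺ p }) (G-complete (fs , cs)))

  suc-length-insertions-lift : ∀ {s} → FullLinear s → suc (length (insertions (lift s))) ≡ n + n
  suc-length-insertions-lift {s} fl = begin
    suc (length (insertions (lift s)))                  ≡⟨ length-insertions (lift s) ⟩
    length (leaves (lift s)) + length (leaves (lift s)) ≡⟨ cong (λ k → k + k) length-leaves ⟩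
    n + n                                               ∎
    where
    open ≡-Reasoning
    length-leaves : length (leaves (lift s)) ≡ n
    length-leaves = begin
      length (leaves (lift s))        ≡⟨ cong length (leaves-rename inject₁ s) ⟩
      length (map inject₁ (leaves s)) ≡⟨ length-map inject₁ (leaves s) ⟩
      length (leaves s)               ≡⟨ ↭-length fl ⟩
      length (allFin n)               ≡⟨ length-tabulate id ⟩
      n                               ∎

canonicalLinear : (m : ℕ) → List (Term (suc m))
canonicalLinear zero    = var zero ∷ []
canonicalLinear (suc m) = Extension.extend (suc m) (canonicalLinear m)

canonicalLinear-sound : ∀ m → All CanonicalLinear (canonicalLinear m)
canonicalLinear-sound zero    = (↭-refl , var zero) ∷ []
canonicalLinear-sound (suc m) = Extension.extend-sound (suc m) (canonicalLinear-sound m)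

canonicalLinear-unique : ∀ m → Unique (canonicalLinear m)
canonicalLinear-unique zero    = [] ∷ []
canonicalLinear-unique (suc m) = Extension.extend-unique (suc m) (canonicalLinear-unique m)

canonicalLinear-complete : ∀ m {t} → CanonicalLinear t → t ∈ canonicalLinear m
canonicalLinear-complete zero    {var zero} _ = here refl
canonicalLinear-complete zero    {a · b} (fl , _) with leaf-∃ a | leaf-∃ b
... | zero , 0∈a | zero , 0∈b =
  ⊥-elim (proj₂ (proj₂ (Unique-++⁻ (leaves a) (FullLinear⇒Unique (a · b) fl))) (0∈a , 0∈b))
canonicalLinear-complete (suc m) {var i} (fl , _)
  with FullLinear⇒∈ (var i) fl zero | FullLinear⇒∈ (var i) fl (suc zero)
... | here refl | here ()
canonicalLinear-complete (suc m) {_ · _} cl = Extension.extend-complete (suc m) (canonicalLinear-complete m) cl λ ()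

length-canonicalLinear-suc : ∀ m → length (canonicalLinear (suc m)) ≡ length (canonicalLinear m) * suc (m + m)
length-canonicalLinear-suc m = length-concatMap-const (insertions ∘ lift) (canonicalLinear m) λ {s} s∈ →
  suc-injective (trans (suc-length-insertions-lift {s} (proj₁ (All.lookup (canonicalLinear-sound m) s∈)))
                       (cong suc (+-suc m m)))
  where open Extension (suc m)

canonicalLinear-count : ∀ m → length (canonicalLinear m) * (2 ^ m * m !) ≡ (2 * m) !
canonicalLinear-count zero    = refl
canonicalLinear-count (suc m) = begin
  length (canonicalLinear (suc m)) * (2 ^ suc m * suc m !)
    ≡⟨ cong (_* (2 ^ suc m * suc m !)) (length-canonicalLinear-suc m) ⟩
  L * suc (m + m) * (2 ^ suc m * suc m !)
    ≡⟨ regroup L m (2 ^ m) (m !) ⟩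
  suc (suc (2 * m)) * (suc (2 * m) * (L * (2 ^ m * m !)))
    ≡⟨ cong (λ k → suc (suc (2 * m)) * (suc (2 * m) * k)) (canonicalLinear-count m) ⟩
  suc (suc (2 * m)) !
    ≡⟨ cong (λ k → suc k !) (+-suc m (m + 0)) ⟨
  (2 * suc m) ! ∎
  where
  open ≡-Reasoning
  open +-*-Solver
  L = length (canonicalLinear m)
  regroup : ∀ L m P F →
            L * suc (m + m) * (2 * P * (suc m * F)) ≡ suc (suc (2 * m)) * (suc (2 * m) * (L * (P * F)))
  regroup = solve 4 (λ L m P F → L :* (con 1 :+ (m :+ m)) :* (con 2 :* P :* ((con 1 :+ m) :* F)) :=
                                 (con 2 :+ con 2 :* m) :* ((con 1 :+ con 2 :* m) :* (L :* (P :* F)))) refl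

length-canonicalLinear : ∀ m → length (canonicalLinear m) ≡ DoubleFact m
length-canonicalLinear m = sym (begin
  (2 * m) ! / (2 ^ m * m !)                                  ≡⟨ cong (_/ (2 ^ m * m !)) (canonicalLinear-count m) ⟨
  length (canonicalLinear m) * (2 ^ m * m !) / (2 ^ m * m !) ≡⟨ m*n/n≡m _ (2 ^ m * m !) ⟩
  length (canonicalLinear m)                                 ∎)
  where
  open ≡-Reasoning
  instance
    2^m*m!≢0 : NonZero (2 ^ m * m !)
    2^m*m!≢0 = m*n≢0 (2 ^ m) (m !) {{m^n≢0 2 m}} {{m !≢0}}

-- Binomial identities

infixl 6.5 _C⁻_

_C⁻_ : ℕ → ℕ → ℕ
n C⁻ zero  = 0
n C⁻ suc k = n C k

nC⁻k+nCk≡[n+1]Ck : ∀ n k → n C⁻ k + n C k ≡ suc n C k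
nC⁻k+nCk≡[n+1]Ck n zero    = refl
nC⁻k+nCk≡[n+1]Ck n (suc k) = nCk+nC[k+1]≡[n+1]C[k+1] n k

[k+1]*[n+1]C[k+1]≡[n+1]*nCk : ∀ n k → suc k * (suc n C suc k) ≡ suc n * (n C k)
[k+1]*[n+1]C[k+1]≡[n+1]*nCk zero    zero    = refl
[k+1]*[n+1]C[k+1]≡[n+1]*nCk zero    (suc k) = *-zeroʳ (suc (suc k))
[k+1]*[n+1]C[k+1]≡[n+1]*nCk (suc n) zero    =
  trans (+-identityʳ _) (trans (nC1≡n (suc (suc n))) (sym (*-identityʳ (suc (suc n)))))
[k+1]*[n+1]C[k+1]≡[n+1]*nCk (suc n) (suc k) = begin
  suc (suc k) * (suc (suc n) C suc (suc k))
    ≡⟨ cong (suc (suc k) *_) (nCk+nC[k+1]≡[n+1]C[k+1] (suc n) (suc k)) ⟨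
  suc (suc k) * (B + B′)
    ≡⟨ split-left k B B′ ⟩
  (suc k * B + B) + suc (suc k) * B′
    ≡⟨ cong₂ (λ x y → (x + B) + y) ([k+1]*[n+1]C[k+1]≡[n+1]*nCk n k) ([k+1]*[n+1]C[k+1]≡[n+1]*nCk n (suc k)) ⟩
  (suc n * (n C k) + B) + suc n * (n C suc k)
    ≡⟨ join-right n (n C k) (n C suc k) B ⟩
  suc n * (n C k + n C suc k) + B
    ≡⟨ cong (λ x → suc n * x + B) (nCk+nC[k+1]≡[n+1]C[k+1] n k) ⟩
  suc n * B + B
    ≡⟨ +-comm (suc n * B) B ⟩
  suc (suc n) * B ∎
  where
  open ≡-Reasoning
  open +-*-Solver
  B  = suc n C suc k
  B′ = suc n C suc (suc k)
  split-left : ∀ k x y → suc (suc k) * (x + y) ≡ (suc k * x + x) + suc (suc k) * y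
  split-left = solve 3 (λ k x y → (con 2 :+ k) :* (x :+ y) := ((con 1 :+ k) :* x :+ x) :+ (con 2 :+ k) :* y) refl
  join-right : ∀ n x y z → (suc n * x + z) + suc n * y ≡ suc n * (x + y) + z
  join-right = solve 4 (λ n x y z → ((con 1 :+ n) :* x :+ z) :+ (con 1 :+ n) :* y := (con 1 :+ n) :* (x :+ y) :+ z) refl

[j+1]*[2j+2]C[j+1]≡[j+2]*[2j+2]Cj : ∀ j → suc j * ((2 * suc j) C suc j) ≡ suc (suc j) * ((2 * suc j) C j)
[j+1]*[2j+2]C[j+1]≡[j+2]*[2j+2]Cj j = begin
  suc j * ((2 * suc j) C suc j)        ≡⟨ cong (λ n → suc j * (n C suc j)) 2[j+1]≡1+n ⟩
  suc j * (suc n C suc j)              ≡⟨ [k+1]*[n+1]C[k+1]≡[n+1]*nCk n j ⟩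
  suc n * (n C j)                      ≡⟨ cong (suc n *_) n-symmetric ⟨
  suc n * (n C suc j)                  ≡⟨ [k+1]*[n+1]C[k+1]≡[n+1]*nCk n (suc j) ⟨
  suc (suc j) * (suc n C suc (suc j))  ≡⟨ cong (suc (suc j) *_) suc-n-symmetric ⟩
  suc (suc j) * (suc n C j)            ≡⟨ cong (λ n → suc (suc j) * (n C j)) 2[j+1]≡1+n ⟨
  suc (suc j) * ((2 * suc j) C j)      ∎
  where
  open ≡-Reasoning
  n = j + suc j
  2[j+1]≡1+n : 2 * suc j ≡ suc n
  2[j+1]≡1+n = cong (suc j +_) (+-identityʳ (suc j))
  n∸[j+1]≡j : n ∸ suc j ≡ j
  n∸[j+1]≡j = m+n∸n≡m j (suc j)
  n-symmetric : n C suc j ≡ n C j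
  n-symmetric = trans (nCk≡nC[n∸k] (m≤n+m (suc j) j)) (cong (n C_) n∸[j+1]≡j)
  suc-n-symmetric : suc n C suc (suc j) ≡ suc n C j
  suc-n-symmetric = trans (nCk≡nC[n∸k] (s≤s (m≤n+m (suc j) j))) (cong (suc n C_) n∸[j+1]≡j)

ballot⇒catalan : ∀ m L → L + (2 * m) C⁻ m ≡ (2 * m) C m → (2 * m) C m ≡ L * suc m
ballot⇒catalan zero    L e = trans (sym e) (trans (+-identityʳ L) (sym (*-identityʳ L)))
ballot⇒catalan (suc j) L e = +-cancelʳ-≡ (suc (suc j) * b) c (L * suc (suc j)) (begin
  c + suc (suc j) * b                ≡⟨ cong (c +_) ([j+1]*[2j+2]C[j+1]≡[j+2]*[2j+2]Cj j) ⟨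
  c + suc j * c                      ≡⟨⟩
  suc (suc j) * c                    ≡⟨ cong (suc (suc j) *_) e ⟨
  suc (suc j) * (L + b)              ≡⟨ distribute j L b ⟩
  L * suc (suc j) + suc (suc j) * b  ∎)
  where
  open ≡-Reasoning
  open +-*-Solver
  b = (2 * suc j) C j
  c = (2 * suc j) C suc j
  distribute : ∀ j x y → suc (suc j) * (x + y) ≡ x * suc (suc j) + suc (suc j) * y
  distribute = solve 3 (λ j x y → (con 2 :+ j) :* (x :+ y) := x :* (con 2 :+ j) :+ (con 2 :+ j) :* y) refl

-- Shift-reduce stacks of shapes

data Shape : Set where
  leaf : Shape
  _⋆_  : Shape → Shape → Shape

size : Shape → ℕ
size leaf    = 1
size (a ⋆ b) = size a + size b

totalSize : List Shape → ℕ
totalSize = sum ∘ map size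

reduce : List Shape → List Shape
reduce (a ∷ b ∷ st) = (b ⋆ a) ∷ st
reduce st           = st

guarded : ∀ {A P : Set} → Dec P → List A → List A
guarded (yes _) xs = xs
guarded (no  _) _  = []

record Stack (p r : ℕ) (st : List Shape) : Set where
  constructor stack
  field
    length≡    : length st + r ≡ suc p
    totalSize≡ : totalSize st ≡ suc p

-- stacks p r lists the stacks of p + 1 − r shapes with p + 1 leaves in total (those a shift-reduce parser
-- reaches after p + 1 shifts and r reductions): first those with a leaf on top, then those with b ⋆ a on
-- top, which come from a ∷ b ∷ … by a reduction.
stacks : ℕ → ℕ → List (List Shape)
stacks zero    zero    = (leaf ∷ []) ∷ []
stacks zero    (suc r) = []
stacks (suc p) zero    = map (leaf ∷_) (stacks p zero)
stacks (suc p) (suc r) = map (leaf ∷_) (stacks p (suc r)) ++ guarded (r ≤? p) (map reduce (stacks (suc p) r))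

data Long : List Shape → Set where
  long : ∀ a b st → Long (a ∷ b ∷ st)

Stack⇒Long : ∀ {p r st} → r ≤ p → Stack (suc p) r st → Long st
Stack⇒Long {st = []}         r≤p (stack len _) = ⊥-elim (1+n≰n (≤-trans (n≤1+n _) (subst (_≤ _) len r≤p)))
Stack⇒Long {st = _ ∷ []}     r≤p (stack len _) = ⊥-elim (1+n≰n (subst (_≤ _) (suc-injective len) r≤p))
Stack⇒Long {st = a ∷ b ∷ st} _   _         = long a b st

Stack-leaf∷ : ∀ {p r st} → Stack p r st → Stack (suc p) r (leaf ∷ st)
Stack-leaf∷ (stack len total) = stack (cong suc len) (cong suc total)

totalSize-reduce : ∀ a b st → totalSize (reduce (a ∷ b ∷ st)) ≡ totalSize (a ∷ b ∷ st)
totalSize-reduce a b st =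
  trans (cong (_+ totalSize st) (+-comm (size b) (size a))) (+-assoc (size a) (size b) (totalSize st))

Stack-reduce : ∀ {p r st} → Long st → Stack p r st → Stack p (suc r) (reduce st)
Stack-reduce {r = r} (long a b st) (stack len total) =
  stack (trans (cong suc (+-suc (length st) r)) len) (trans (totalSize-reduce a b st) total)

Stack-unreduce : ∀ {p r a b st} → Stack p (suc r) ((a ⋆ b) ∷ st) → Stack p r (b ∷ a ∷ st)
Stack-unreduce {r = r} {a} {b} {st} (stack len total) =
  stack (trans (cong suc (sym (+-suc (length st) r))) len) (trans (sym (totalSize-reduce b a st)) total)

size≥1 : ∀ x → 1 ≤ size x
size≥1 leaf    = s≤s z≤n
size≥1 (a ⋆ b) = ≤-trans (size≥1 a) (m≤m+n (size a) (size b))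

length≤totalSize : ∀ st → length st ≤ totalSize st
length≤totalSize []       = z≤n
length≤totalSize (x ∷ st) = +-mono-≤ (size≥1 x) (length≤totalSize st)

Stack⇒≤ : ∀ {p r x st} → Stack p r (x ∷ st) → r ≤ p
Stack⇒≤ {r = r} {st = st} (stack len _) = subst (r ≤_) (suc-injective len) (m≤n+m r (length st))

¬Stack-zero-⋆ : ∀ {p a b st} → ¬ Stack p zero ((a ⋆ b) ∷ st)
¬Stack-zero-⋆ {a = a} {b} {st} (stack len total) = 1+n≰n (begin
  suc (length ((a ⋆ b) ∷ st))               ≤⟨ +-mono-≤ (+-mono-≤ (size≥1 a) (size≥1 b)) (length≤totalSize st) ⟩
  totalSize ((a ⋆ b) ∷ st)                  ≡⟨ trans total (sym len) ⟩
  length ((a ⋆ b) ∷ st) + 0                 ≡⟨ +-identityʳ _ ⟩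
  length ((a ⋆ b) ∷ st)                     ∎)
  where open ≤-Reasoning

stacks-sound : ∀ p r → All (Stack p r) (stacks p r)
stacks-sound zero    zero    = stack refl refl ∷ []
stacks-sound zero    (suc r) = []
stacks-sound (suc p) zero    = All.map⁺ (All.map Stack-leaf∷ (stacks-sound p zero))
stacks-sound (suc p) (suc r) with r ≤? p
... | yes r≤p = All.++⁺ (All.map⁺ (All.map Stack-leaf∷ (stacks-sound p (suc r))))
                        (All.map⁺ (All.map (λ s → Stack-reduce (Stack⇒Long r≤p s) s) (stacks-sound (suc p) r)))
... | no  _   = All.++⁺ (All.map⁺ (All.map Stack-leaf∷ (stacks-sound p (suc r)))) []

reduce-injective : ∀ {x y} → Long x → Long y → reduce x ≡ reduce y → x ≡ y
reduce-injective (long a b st) (long .a .b .st) refl = refl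

reduce-≢leaf∷ : ∀ {x st} → Long x → reduce x ≢ leaf ∷ st
reduce-≢leaf∷ (long a b st) ()

stacks-unique : ∀ p r → Unique (stacks p r)
stacks-unique zero    zero    = [] ∷ []
stacks-unique zero    (suc r) = []
stacks-unique (suc p) zero    = UniqueP.map⁺ ∷-injectiveʳ (stacks-unique p zero)
stacks-unique (suc p) (suc r) with r ≤? p
... | no  _   = UniqueP.++⁺ (UniqueP.map⁺ ∷-injectiveʳ (stacks-unique p (suc r))) [] λ { (_ , ()) }
... | yes r≤p = UniqueP.++⁺ (UniqueP.map⁺ ∷-injectiveʳ (stacks-unique p (suc r)))
                            (AllPairs.map⁺ (Unique⇒AllPairs-¬ reduce-injective longs (stacks-unique (suc p) r)))
                            leaf-top∉reduced
  where
  longs : All Long (stacks (suc p) r)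
  longs = All.map (Stack⇒Long r≤p) (stacks-sound (suc p) r)
  leaf-top∉reduced : Disjoint (map (leaf ∷_) (stacks p (suc r))) (map reduce (stacks (suc p) r))
  leaf-top∉reduced (v∈ˡ , v∈ʳ) =
    let _ , _ , v≡leaf∷  = ∈-map⁻ (leaf ∷_) v∈ˡ
        _ , st∈ , v≡reduce = ∈-map⁻ reduce v∈ʳ
    in reduce-≢leaf∷ (All.lookup longs st∈) (trans (sym v≡reduce) v≡leaf∷)

stacks-complete : ∀ p r st → Stack p r st → st ∈ stacks p r
stacks-complete p       r       []             (stack _ ())
stacks-complete zero    zero    (leaf ∷ [])    _ = here refl
stacks-complete zero    zero    ((_ ⋆ _) ∷ []) s = ⊥-elim (¬Stack-zero-⋆ s)
stacks-complete zero    zero    (_ ∷ _ ∷ _)    (stack () _)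
stacks-complete zero    (suc r) (_ ∷ _)        s with Stack⇒≤ s
... | ()
stacks-complete (suc p) zero    (leaf ∷ st)    (stack len total) =
  ∈-map⁺ (leaf ∷_) (stacks-complete p zero st (stack (suc-injective len) (suc-injective total)))
stacks-complete (suc p) (suc r) (leaf ∷ st)    (stack len total) =
  ∈-++⁺ˡ (∈-map⁺ (leaf ∷_) (stacks-complete p (suc r) st (stack (suc-injective len) (suc-injective total))))
stacks-complete (suc p) zero    ((_ ⋆ _) ∷ _)  s = ⊥-elim (¬Stack-zero-⋆ s)
stacks-complete (suc p) (suc r) ((a ⋆ b) ∷ st) s with r ≤? p
... | yes _   = ∈-++⁺ʳ (map (leaf ∷_) (stacks p (suc r)))
                  (∈-map⁺ reduce (stacks-complete (suc p) r (b ∷ a ∷ st) (Stack-unreduce s)))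
... | no  r≰p = ⊥-elim (r≰p (s≤s⁻¹ (Stack⇒≤ s)))

stacks-empty : ∀ p r → p < r → stacks p r ≡ []
stacks-empty zero    (suc r) _         = refl
stacks-empty (suc p) (suc r) (s≤s p<r) with r ≤? p
... | yes r≤p = ⊥-elim (<⇒≱ p<r r≤p)
... | no  _   = cong (λ xs → map (leaf ∷_) xs ++ []) (stacks-empty p (suc r) (≤-trans p<r (n≤1+n r)))

length-stacks : ∀ p r → r ≤ suc p → length (stacks p r) + (p + r) C⁻ r ≡ (p + r) C r
length-stacks zero    zero          _ = refl
length-stacks zero    (suc zero)    _ = refl
length-stacks zero    (suc (suc r)) (s≤s ())
length-stacks (suc p) zero          _ = cong (_+ 0) (trans (length-map (leaf ∷_) (stacks p zero)) (length-stacks-zero p))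
  where
  length-stacks-zero : ∀ p → length (stacks p zero) ≡ 1
  length-stacks-zero zero    = refl
  length-stacks-zero (suc p) = trans (length-map (leaf ∷_) (stacks p zero)) (length-stacks-zero p)
length-stacks (suc p) (suc r) r≤2+p with r ≤? p
... | yes r≤p = begin
  length (map (leaf ∷_) (stacks p (suc r)) ++ map reduce (stacks (suc p) r)) + suc n C r
    ≡⟨ cong (_+ suc n C r) (trans (length-++ (map (leaf ∷_) (stacks p (suc r))))
                                  (cong₂ _+_ (length-map (leaf ∷_) (stacks p (suc r))) (length-map reduce (stacks (suc p) r)))) ⟩
  (f₁ + f₂) + suc n C r
    ≡⟨ cong ((f₁ + f₂) +_) (nC⁻k+nCk≡[n+1]Ck n r) ⟨
  (f₁ + f₂) + (n C⁻ r + n C r)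
    ≡⟨ regroup f₁ f₂ (n C⁻ r) (n C r) ⟩
  (f₂ + n C⁻ r) + (f₁ + n C r)
    ≡⟨ cong₂ _+_ f₂-ballot (length-stacks p (suc r) (s≤s r≤p)) ⟩
  n C r + n C suc r
    ≡⟨ nCk+nC[k+1]≡[n+1]C[k+1] n r ⟩
  suc n C suc r ∎
  where
  open ≡-Reasoning
  open +-*-Solver
  n  = p + suc r
  f₁ = length (stacks p (suc r))
  f₂ = length (stacks (suc p) r)
  f₂-ballot : f₂ + n C⁻ r ≡ n C r
  f₂-ballot = subst (λ m → f₂ + m C⁻ r ≡ m C r) (sym (+-suc p r))
                    (length-stacks (suc p) r (≤-trans r≤p (≤-trans (n≤1+n p) (n≤1+n (suc p)))))
  regroup : ∀ a b c d → (a + b) + (c + d) ≡ (b + c) + (a + d)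
  regroup = solve 4 (λ a b c d → (a :+ b) :+ (c :+ d) := (b :+ c) :+ (a :+ d)) refl
... | no  r≰p with m≤n⇒m<n∨m≡n (s≤s⁻¹ r≤2+p)
...   | inj₁ r<1+p = ⊥-elim (r≰p (s≤s⁻¹ r<1+p))
...   | inj₂ refl rewrite stacks-empty p (suc r) (m<n⇒m<1+n (n<1+n p)) =
  sym (trans (nCk≡nC[n∸k] (m≤n+m (suc (suc p)) (suc p)))
             (cong ((suc p + suc (suc p)) C_) (m+n∸n≡m (suc p) (suc (suc p)))))

Stack-singleton : ∀ {m st} → Stack m m st → ∃ λ s → st ≡ s ∷ [] × size s ≡ suc m
Stack-singleton {st = []}          (stack len _)     = ⊥-elim (1+n≰n (≤-reflexive (sym len)))
Stack-singleton {st = s ∷ []}      (stack _ total)   = s , refl , trans (sym (+-identityʳ (size s))) total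
Stack-singleton {m} {_ ∷ _ ∷ st}   (stack len _)     =
  ⊥-elim (1+n≰n (subst (suc m ≤_) (suc-injective len) (s≤s (m≤n+m m (length st)))))

top : List Shape → Shape
top []      = leaf
top (s ∷ _) = s

shapes : ℕ → List Shape
shapes m = map top (stacks m m)

shapes-sound : ∀ m → All (λ s → size s ≡ suc m) (shapes m)
shapes-sound m = All.map⁺ (All.map top-size (stacks-sound m m))
  where
  top-size : ∀ {st} → Stack m m st → size (top st) ≡ suc m
  top-size s with Stack-singleton s
  ... | _ , refl , size≡ = size≡

shapes-unique : ∀ m → Unique (shapes m)
shapes-unique m = AllPairs.map⁺ (Unique⇒AllPairs-¬ top-injective singletons (stacks-unique m m))
  where
  Singleton : List Shape → Set
  Singleton st = ∃ λ s → st ≡ s ∷ []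
  singletons : All Singleton (stacks m m)
  singletons = All.map (λ st → let s , st≡ , _ = Stack-singleton st in s , st≡) (stacks-sound m m)
  top-injective : ∀ {x y} → Singleton x → Singleton y → top x ≡ top y → x ≡ y
  top-injective (_ , refl) (_ , refl) refl = refl

shapes-complete : ∀ m {s} → size s ≡ suc m → s ∈ shapes m
shapes-complete m {s} size≡ =
  ∈-map⁺ top (stacks-complete m m (s ∷ []) (stack refl (trans (+-identityʳ (size s)) size≡)))

length-shapes : ∀ m → length (shapes m) + (2 * m) C⁻ m ≡ (2 * m) C m
length-shapes m = begin
  length (shapes m) + (2 * m) C⁻ m    ≡⟨ cong (λ L → L + (2 * m) C⁻ m) (length-map top (stacks m m)) ⟩
  length (stacks m m) + (2 * m) C⁻ m  ≡⟨ cong (λ n → length (stacks m m) + n C⁻ m) 2m≡m+m ⟩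
  length (stacks m m) + (m + m) C⁻ m  ≡⟨ length-stacks m m (n≤1+n m) ⟩
  (m + m) C m                         ≡⟨ cong (_C m) 2m≡m+m ⟨
  (2 * m) C m                         ∎
  where
  open ≡-Reasoning
  2m≡m+m : 2 * m ≡ m + m
  2m≡m+m = cong (m +_) (+-identityʳ m)

-- Bracketings

shape : ∀ {n} → Term n → Shape
shape (var _) = leaf
shape (s · t) = shape s ⋆ shape t

size-shape : ∀ {n} (t : Term n) → size (shape t) ≡ length (leaves t)
size-shape (var _) = refl
size-shape (s · t) = trans (cong₂ _+_ (size-shape s) (size-shape t)) (sym (length-++ (leaves s)))

-- var zero only pads a list that is shorter than the shape.
label : ∀ {n} → Shape → List (Fin (suc n)) → Term (suc n)
label leaf    []      = var zero
label leaf    (x ∷ _) = var x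
label (a ⋆ b) xs      = label a (take (size a) xs) · label b (drop (size a) xs)

shape-label : ∀ {n} s (xs : List (Fin (suc n))) → shape (label s xs) ≡ s
shape-label leaf    []      = refl
shape-label leaf    (_ ∷ _) = refl
shape-label (a ⋆ b) xs      = cong₂ _⋆_ (shape-label a _) (shape-label b _)

label-shape : ∀ {n} (t : Term (suc n)) → label (shape t) (leaves t) ≡ t
label-shape (var i) = refl
label-shape (a · b)
  rewrite size-shape a | take-length-++ (leaves a) (leaves b) | drop-length-++ (leaves a) (leaves b) =
  cong₂ _·_ (label-shape a) (label-shape b)

leaves-label : ∀ {n} s (xs : List (Fin (suc n))) → length xs ≡ size s → leaves (label s xs) ≡ xs
leaves-label leaf    (x ∷ [])     _ = refl
leaves-label (a ⋆ b) xs          len =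
  trans (cong₂ _++_ (leaves-label a (take (size a) xs) length-take≡) (leaves-label b (drop (size a) xs) length-drop≡))
        (take++drop≡id (size a) xs)
  where
  length-take≡ : length (take (size a) xs) ≡ size a
  length-take≡ = trans (length-take (size a) xs) (m≤n⇒m⊓n≡m (subst (size a ≤_) (sym len) (m≤m+n (size a) (size b))))
  length-drop≡ : length (drop (size a) xs) ≡ size b
  length-drop≡ = trans (length-drop (size a) xs) (trans (cong (_∸ size a) len) (m+n∸m≡n (size a) (size b)))

bracketings : (m : ℕ) → List (Term (suc m))
bracketings m = map (λ s → label s (allFin (suc m))) (shapes m)

bracketings-sound : ∀ m → All Bracketing (bracketings m)
bracketings-sound m = All.map⁺ (All.map (λ {s} size≡ → leaves-label s (allFin (suc m)) (trans (length-tabulate id) (sym size≡)))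
                                        (shapes-sound m))

bracketings-unique : ∀ m → Unique (bracketings m)
bracketings-unique m = UniqueP.map⁺ label-injective (shapes-unique m)
  where
  label-injective : ∀ {s s′} → label s (allFin (suc m)) ≡ label s′ (allFin (suc m)) → s ≡ s′
  label-injective {s} {s′} eq = trans (sym (shape-label s _)) (trans (cong shape eq) (shape-label s′ _))

bracketings-complete : ∀ m {t} → Bracketing t → t ∈ bracketings m
bracketings-complete m {t} br =
  subst (_∈ bracketings m) (trans (cong (label (shape t)) (sym br)) (label-shape t))
    (∈-map⁺ (λ s → label s (allFin (suc m)))
            (shapes-complete m (trans (size-shape t) (trans (cong length br) (length-tabulate id)))))

length-bracketings : ∀ m → length (bracketings m) ≡ Catalan m
length-bracketings m = sym (begin
  ((2 * m) C m) / suc m        ≡⟨ cong (_/ suc m) (ballot⇒catalan m L (length-shapes m)) ⟩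
  L * suc m / suc m            ≡⟨ m*n/n≡m L (suc m) ⟩
  L                            ≡⟨ length-map _ (shapes m) ⟨
  length (bracketings m)       ∎)
  where
  open ≡-Reasoning
  L = length (shapes m)

Increasing : ∀ {n} → List (Fin n) → Set
Increasing = AllPairs (λ i j → toℕ i < toℕ j)

Increasing⇒Canonical : ∀ {n} (t : Term n) → Increasing (leaves t) → Canonical t
Increasing⇒Canonical (var i) _   = var i
Increasing⇒Canonical (a · b) inc with AllPairs-++⁻ (leaves a) inc | minLeaf-∈ a | minLeaf-∈ b
... | inc-a , inc-b , a<b | i , i∈a , i≡a | j , j∈b , j≡b =
  node (Increasing⇒Canonical a inc-a) (Increasing⇒Canonical b inc-b)
       (subst₂ _<_ i≡a j≡b (All.lookup (All.lookup a<b i∈a) j∈b))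

Bracketing⇒CanonicalLinear : ∀ {n} {t : Term n} → Bracketing t → CanonicalLinear t
Bracketing⇒CanonicalLinear {t = t} br =
  ↭-reflexive br , Increasing⇒Canonical t (subst Increasing (sym br) (AllPairs.tabulate⁺-< id))

s-ac-rps : ∀ m → s-ac _*ʳ_ (suc m) (DoubleFact m)
s-ac-rps m = subst (s-ac _*ʳ_ (suc m)) (length-canonicalLinear m)
  (numDistinctOps _*ʳ_ FullLinear (canonicalLinear m) (All.map proj₁ sound)
    (CanonicalLinear-distinctOps sound (canonicalLinear-unique m))
    λ t fl → canon t , canonicalLinear-complete m (canon-CanonicalLinear t fl) , ⟦canon⟧ _*ʳ_ *ʳ-comm t)
  where
  sound = canonicalLinear-sound m

s-br-rps : ∀ m → s-br _*ʳ_ (suc m) (Catalan m)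
s-br-rps m = subst (s-br _*ʳ_ (suc m)) (length-bracketings m)
  (numDistinctOps _*ʳ_ Bracketing (bracketings m) sound
    (CanonicalLinear-distinctOps (All.map Bracketing⇒CanonicalLinear sound) (bracketings-unique m))
    λ t br → t , bracketings-complete m br , λ _ → refl)
  where
  sound = bracketings-sound m

proposition4p5 : (m : ℕ) → s-ac _*ʳ_ (suc m) (DoubleFact m) × s-br _*ʳ_ (suc m) (Catalan m)
proposition4p5 m = s-ac-rps m , s-br-rps m
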